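{- There is a deterministic online exploration algorithm with advice that, for every cycle graph $G$ on $n$ vertices with positive edge weights and every starting vertex $s$, given a suitable advice string of $\lceil \log_2 n\rceil$ bits, explores $G$ with cost exactly $\mathrm{cost}_{\mathrm{opt}}(G,s)$ (competitive ratio $1$).
   Context: Each edge $e$ has positive weight $c(e)$. Online exploration model: vertices have unique identifiers; a searcher starts at $s$ knowing only $s$; upon arriving at $v$ it learns identifiers of all neighbours of $v$ and weights of all incident edges; each edge traversal costs its weight; the searcher must perform a closed walk from $s$ visiting all vertices and returning to $s$. $\mathrm{cost}_{\mathrm{opt}}(G,s)$ is the minimum cost of such a closed walk. Advice model: before the exploration starts, an oracle that knows the entire graph, the starting vertex and the (deterministic) algorithm gives the searcher a bit string (the advice), which the algorithm may use in its decisions.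
   Formalization: The edge weights of each cycle graph take values in the positive rationals. -}

module Defs where

open import Data.Nat using (ℕ; zero; suc; _+_; _∸_; NonZero; _≤?_)
open import Data.Nat.DivMod using (_mod_)
import Data.Nat.Properties as ℕP
open import Data.Fin using (Fin; toℕ)
open import Data.Fin.Properties using (_≟_)
open import Data.Rational using (ℚ; Positive; 0ℚ) renaming (_+_ to _+ℚ_)
open import Data.Bool using (Bool)
open import Data.List using (List; []; _∷_; head; last)
open import Data.List.Membership.Propositional using (_∈_)
open import Data.Maybe using (Maybe; just; nothing)
import Data.Maybe as Maybe
open import Data.Product using (_×_; _,_)
open import Data.Sum using (_⊎_)
open import Data.Unit using (⊤)
open import Function.Definitions using (Injective)
open import Relation.Binary.PropositionalEquality using (_≡_)
open import Relation.Nullary using (yes; no)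

-- Vertices are Fin n, arranged cyclically: vertex i is joined to
-- next i = (i+1) mod n by the edge "i", of weight (weight i).
-- Every cycle graph with unique identifiers is isomorphic to one of these.

module _ {n : ℕ} .{{_ : NonZero n}} where

  next : Fin n → Fin n
  next i = suc (toℕ i) mod n

  prev : Fin n → Fin n
  prev i = (toℕ i + (n ∸ 1)) mod n

  Adj : Fin n → Fin n → Set
  Adj i j = (j ≡ next i) ⊎ (i ≡ next j)

record CycleGraph (n : ℕ) .{{_ : NonZero n}} : Set where
  field
    label      : Fin n → ℕ
    label-inj  : Injective _≡_ _≡_ label
    weight     : Fin n → ℚ          -- weight of edge {i , next i}
    weight-pos : ∀ i → Positive (weight i)

open CycleGraph public

module _ {n : ℕ} .{{_ : NonZero n}} (G : CycleGraph n) where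

  -- cost of traversing the edge between adjacent vertices i and j
  -- (the value for non-adjacent pairs is irrelevant: walks are required
  -- to consist of adjacent steps)
  stepCost : Fin n → Fin n → ℚ
  stepCost i j with j ≟ next i
  ... | yes _ = weight G i
  ... | no _ with i ≟ next j
  ...   | yes _ = weight G j
  ...   | no _ = 0ℚ

  walkCost : List (Fin n) → ℚ
  walkCost []           = 0ℚ
  walkCost (x ∷ [])     = 0ℚ
  walkCost (x ∷ y ∷ r)  = stepCost x y +ℚ walkCost (y ∷ r)

AdjChain : {n : ℕ} .{{_ : NonZero n}} → List (Fin n) → Set
AdjChain []          = ⊤
AdjChain (x ∷ [])    = ⊤
AdjChain (x ∷ y ∷ r) = Adj x y × AdjChain (y ∷ r)

IsExploration : {n : ℕ} .{{_ : NonZero n}} → Fin n → List (Fin n) → Set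
IsExploration {n} s W =
  (head W ≡ just s) × (last W ≡ just s) × AdjChain W × (∀ (v : Fin n) → v ∈ W)

-- What the searcher learns on arriving at a vertex v: the identifier of v
-- and the list of (identifier, edge weight) of its neighbours. The list is
-- sorted by identifier, i.e. it is a canonical encoding of the unordered
-- set of neighbours (no orientation information is leaked).
Observation : Set
Observation = ℕ × List (ℕ × ℚ)

data Move : Set where
  stop : Move          -- terminate (must then be back at s)
  go   : ℕ → Move      -- traverse the edge to the neighbour with this identifier

-- A deterministic online algorithm with advice: given the advice string and
-- the history of all observations so far (most recent first; the head is
-- the current vertex), it decides the next move.
Algorithm : Set
Algorithm = List Bool → List Observation → Move

module _ {n : ℕ} .{{_ : NonZero n}} (G : CycleGraph n) where

  sortedNbrs : Fin n → List (ℕ × ℚ)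
  sortedNbrs v with label G (prev v) ≤? label G (next v)
  ... | yes _ = (label G (prev v) , weight G (prev v)) ∷ (label G (next v) , weight G v) ∷ []
  ... | no _  = (label G (next v) , weight G v) ∷ (label G (prev v) , weight G (prev v)) ∷ []

  observe : Fin n → Observation
  observe v = label G v , sortedNbrs v

  moveTo : Fin n → ℕ → Maybe (Fin n)
  moveTo v x with x Data.Nat.≟ label G (next v)
  ... | yes _ = just (next v)
  ... | no _ with x Data.Nat.≟ label G (prev v)
  ...   | yes _ = just (prev v)
  ...   | no _  = nothing

  runFrom : Algorithm → List Bool → ℕ → Fin n → List Observation → Maybe (List (Fin n))
  runFrom A adv fuel v h with A adv (observe v ∷ h)
  ... | stop = just (v ∷ [])
  ... | go x with fuel | moveTo v x
  ...   | zero    | _       = nothing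
  ...   | suc f   | nothing = nothing
  ...   | suc f   | just w  = Maybe.map (v ∷_) (runFrom A adv f w (observe v ∷ h))

  run : Algorithm → List Bool → ℕ → Fin n → Maybe (List (Fin n))
  run A adv fuel s = runFrom A adv fuel s []

module Submission where

-- Number the positions of the cycle from the start s in the direction of
-- its neighbour with the smaller identifier: u j lies j steps ahead and e j
-- is the edge from u j to u (j + 1). With advice k the explorer walks to u k.
-- There it closes the cycle through e k if that edge leads back to s and is
-- not heavier than the way back; otherwise it turns, sweeps backwards past s
-- round to u (k + 1) and walks home. Its walk weighs at most twice the path
-- obtained by deleting e k, and at most the whole cycle when k = n - 1
-- (module Execution). Conversely an exploration either crosses every edge,
-- or misses some edge e and then crosses every other edge twice (module
-- LowerBound). So the advice k = n - 1 is optimal when the cycle weighs at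
-- most twice the path avoiding a heaviest edge e*, and otherwise the
-- position of e* is (module Optimality); as k < n it fits in ⌈log₂ n⌉ bits.

open import Defs
open import Data.Nat using (ℕ; NonZero; _≤_)
open import Data.Nat.Logarithm using (⌈log₂_⌉)
open import Data.Fin using (Fin)
open import Data.Bool using (Bool)
open import Data.List using (List; length)
open import Data.Maybe using (just)
import Data.Maybe as Maybe
open import Data.Product using (Σ; _×_)
open import Relation.Binary.PropositionalEquality using (_≡_)
import Data.Rational as ℚ

open import Data.Nat as ℕ using (zero; suc; _+_; _∸_; _*_; _^_; _<_; z≤n; s≤s; _%_; _/_; ⌊_/2⌋; ⌈_/2⌉)
open import Data.Nat.Logarithm.Core using (⌈log2⌉)
open import Induction.WellFounded using (Acc; acc)
import Data.Nat.Induction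
open import Relation.Binary.Bundles using (DecTotalOrder)
import Data.List.Extrema
open import Data.Nat.Properties as ℕP using ()
open import Data.Nat.DivMod using (m≡m%n+[m/n]*n; m<n⇒m%n≡m; [m+n]%n≡m%n; %-distribˡ-+; m%n%n≡m%n; m%n<n; n%n≡0)
open import Data.Nat.Divisibility using (divides; ∣⇒≤)
open import Data.Nat.GeneralisedArithmetic using (iterate)
open import Data.Fin as Fin using (toℕ)
open import Data.Fin.Properties as FinP using (toℕ-injective; toℕ<n; toℕ-fromℕ<)
open import Data.Bool using (true; false; if_then_else_; _∧_)
open import Data.List using ([]; _∷_; _++_; _∷ʳ_; head; last; applyUpTo; allFin; filter)
open import Data.List.Properties using (applyUpTo-∷ʳ)
open import Data.Product using (_,_; proj₁; proj₂; ∃-syntax)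
open import Data.Sum using (_⊎_; inj₁; inj₂)
open import Data.Empty using (⊥; ⊥-elim)
import Data.Bool.Properties
import Data.Sum
open import Data.Unit using (tt)
open import Function using (_∘_; mk⇔)
open import Relation.Binary.Definitions using (tri<; tri≈; tri>)
open import Relation.Nullary using (¬_; ¬?; yes; no; Dec; does)
open import Relation.Nullary.Decidable using (dec-true; dec-false; does-⇔)
open import Data.Rational using (ℚ; 0ℚ) renaming (_+_ to _+ℚ_; _≤_ to _≤ℚ_; _<_ to _<ℚ_)
import Data.Rational.Properties as ℚP
open import Algebra.Properties.CommutativeMonoid.Mult ℚP.+-0-commutativeMonoid
  using () renaming (_×_ to _·_; ×-distrib-+ to ·-distrib-+)
open import Algebra.Bundles using (CommutativeMonoid)
open import Algebra.Properties.CommutativeSemigroup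
  (CommutativeMonoid.commutativeSemigroup ℚP.+-0-commutativeMonoid) using (x∙yz≈y∙xz)
open import Data.List.Membership.Propositional using (_∈_; _∉_)
open import Data.List.Membership.Propositional.Properties using (∈-filter⁻; ∈-allFin; ∈-∃++; ∈-++⁺ˡ; ∈-++⁺ʳ; ∈-applyUpTo⁺)
import Data.List.Membership.DecPropositional as DecMembership
open import Data.List.Relation.Unary.All as All using (All; []; _∷_)
open import Data.List.Relation.Unary.Any using (here; there)
open import Data.List.Relation.Unary.Unique.Propositional using (Unique)
import Data.List.Relation.Unary.Unique.Propositional.Properties as Uniqueₚ
open import Data.List.Relation.Unary.AllPairs using ([]; _∷_)
open import Relation.Binary.PropositionalEquality
  using (_≢_; refl; sym; trans; cong; cong₂; subst; module ≡-Reasoning)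

module _ {a} {A : Set a} where

  iterate-suc : ∀ (f : A → A) x i → iterate f x (suc i) ≡ f (iterate f x i)
  iterate-suc f x zero    = refl
  iterate-suc f x (suc i) = iterate-suc f (f x) i

  iterate-+ : ∀ (f : A → A) x i j → iterate f x (i + j) ≡ iterate f (iterate f x i) j
  iterate-+ f x zero    j = refl
  iterate-+ f x (suc i) j = iterate-+ f (f x) i j

  iterate-inverse : ∀ {f g : A → A} → (∀ y → g (f y) ≡ y) →
                    ∀ x i → iterate g (iterate f x i) i ≡ x
  iterate-inverse gf x zero = refl
  iterate-inverse {f} {g} gf x (suc i) = begin
    iterate g (iterate f x (suc i)) (suc i) ≡⟨ cong (λ y → iterate g y (suc i)) (iterate-suc f x i) ⟩
    iterate g (g (f (iterate f x i))) i     ≡⟨ cong (λ y → iterate g y i) (gf _) ⟩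
    iterate g (iterate f x i) i             ≡⟨ iterate-inverse gf x i ⟩
    x                                       ∎
    where open ≡-Reasoning

  Aperiodic : (A → A) → ℕ → Set a
  Aperiodic f n = ∀ y d → 0 < d → d < n → iterate f y d ≢ y

  iterate-distinct : ∀ {f n} → Aperiodic f n →
                     ∀ x {i j} → i < j → j < n → iterate f x i ≢ iterate f x j
  iterate-distinct {f} ap x {i} {j} i<j j<n eq =
    ap (iterate f x i) (j ∸ i) (ℕP.m<n⇒0<n∸m i<j) (ℕP.≤-<-trans (ℕP.m∸n≤m j i) j<n) (begin
      iterate f (iterate f x i) (j ∸ i) ≡⟨ iterate-+ f x i (j ∸ i) ⟨
      iterate f x (i + (j ∸ i))         ≡⟨ cong (iterate f x) (ℕP.m+[n∸m]≡n (ℕP.<⇒≤ i<j)) ⟩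
      iterate f x j                     ≡⟨ eq ⟨
      iterate f x i                     ∎)
    where open ≡-Reasoning

trace : ∀ {a} {A : Set a} → (A → A) → A → ℕ → List A
trace f x m = applyUpTo (iterate f x) m

module _ {a} {A : Set a} where

  head-trace : ∀ (f : A → A) x m {W} → head W ≡ just (iterate f x m) → head (trace f x m ++ W) ≡ just x
  head-trace f x zero    hd = hd
  head-trace f x (suc m) hd = refl

  last-++ : ∀ (xs : List A) y ys → last (xs ++ y ∷ ys) ≡ last (y ∷ ys)
  last-++ []            y ys = refl
  last-++ (x ∷ [])      y ys = refl
  last-++ (x ∷ x′ ∷ xs) y ys = last-++ (x′ ∷ xs) y ys

  last-++-just : ∀ (xs : List A) {ys z} → last ys ≡ just z → last (xs ++ ys) ≡ just z
  last-++-just xs {y ∷ ys} eq = trans (last-++ xs y ys) eq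

  applyUpTo-cong : ∀ {f g : ℕ → A} → (∀ j → f j ≡ g j) → ∀ m → applyUpTo f m ≡ applyUpTo g m
  applyUpTo-cong f≗g zero    = refl
  applyUpTo-cong f≗g (suc m) = cong₂ _∷_ (f≗g 0) (applyUpTo-cong (f≗g ∘ suc) m)

  applyUpTo-++ : ∀ (f : ℕ → A) a b → applyUpTo f (a + b) ≡ applyUpTo f a ++ applyUpTo (λ j → f (a + j)) b
  applyUpTo-++ f zero    b = refl
  applyUpTo-++ f (suc a) b = cong (f 0 ∷_) (applyUpTo-++ (f ∘ suc) a b)

  head-∈ : ∀ {W : List A} {x} → head W ≡ just x → x ∈ W
  head-∈ {x ∷ W} refl = here refl

does-true : ∀ {P : Set} (d : Dec P) → does d ≡ true → P
does-true (yes p) _ = p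

does-false : ∀ {P : Set} (d : Dec P) → does d ≡ false → ¬ P
does-false (no ¬p) _ = ¬p

record IsRotation {a} {A : Set a} (n : ℕ) (f g : A → A) : Set a where
  field
    left-inverse  : ∀ x → g (f x) ≡ x
    right-inverse : ∀ x → f (g x) ≡ x
    period        : ∀ x → iterate f x n ≡ x
    aperiodic     : Aperiodic f n
    reaches       : ∀ x y → ∃[ i ] i < n × iterate f x i ≡ y

reverse : ∀ {a} {A : Set a} {n f g} → IsRotation {A = A} n f g → IsRotation n g f
reverse {n = n} {f = f} {g} R = record
  { left-inverse  = right-inverse
  ; right-inverse = left-inverse
  ; period        = λ x → trans (cong (λ y → iterate g y n) (sym (period x)))
                                (iterate-inverse {f = f} {g} left-inverse x n)
  ; aperiodic     = λ y d 0<d d<n eq → aperiodic y d 0<d d<n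
                      (trans (cong (λ z → iterate f z d) (sym eq)) (iterate-inverse {f = g} {f} right-inverse y d))
  ; reaches       = λ x y → let (i , i<n , eq) = reaches y x in
                      i , i<n , trans (cong (λ z → iterate g z i) (sym eq)) (iterate-inverse {f = f} {g} left-inverse y i)
  }
  where open IsRotation R

module CycleArithmetic {n : ℕ} .{{_ : NonZero n}} where

  toℕ-next : ∀ (x : Fin n) → toℕ (next x) ≡ suc (toℕ x) % n
  toℕ-next x = toℕ-fromℕ< _

  toℕ-prev : ∀ (x : Fin n) → toℕ (prev x) ≡ (toℕ x + (n ∸ 1)) % n
  toℕ-prev x = toℕ-fromℕ< _

  %-absorbˡ : ∀ a b → (a % n + b) % n ≡ (a + b) % n
  %-absorbˡ a b = begin
    (a % n + b) % n         ≡⟨ %-distribˡ-+ (a % n) b n ⟩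
    (a % n % n + b % n) % n ≡⟨ cong (λ z → (z + b % n) % n) (m%n%n≡m%n a n) ⟩
    (a % n + b % n) % n     ≡⟨ %-distribˡ-+ a b n ⟨
    (a + b) % n             ∎
    where open ≡-Reasoning

  %-absorbʳ : ∀ a b → (a + b % n) % n ≡ (a + b) % n
  %-absorbʳ a b = begin
    (a + b % n) % n ≡⟨ cong (_% n) (ℕP.+-comm a (b % n)) ⟩
    (b % n + a) % n ≡⟨ %-absorbˡ b a ⟩
    (b + a) % n     ≡⟨ cong (_% n) (ℕP.+-comm b a) ⟩
    (a + b) % n     ∎
    where open ≡-Reasoning

  toℕ-+n : ∀ (x : Fin n) → (toℕ x + n) % n ≡ toℕ x
  toℕ-+n x = trans ([m+n]%n≡m%n (toℕ x) n) (m<n⇒m%n≡m (toℕ<n x))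

  suc-+-pred : ∀ a → suc (a + (n ∸ 1)) ≡ a + n
  suc-+-pred a = trans (sym (ℕP.+-suc a (n ∸ 1))) (cong (a +_) (ℕP.suc-pred n))

  prev-next : ∀ x → prev (next x) ≡ x
  prev-next x = toℕ-injective (begin
    toℕ (prev (next x))                ≡⟨ toℕ-prev (next x) ⟩
    (toℕ (next x) + (n ∸ 1)) % n       ≡⟨ cong (λ z → (z + (n ∸ 1)) % n) (toℕ-next x) ⟩
    (suc (toℕ x) % n + (n ∸ 1)) % n    ≡⟨ %-absorbˡ (suc (toℕ x)) (n ∸ 1) ⟩
    suc (toℕ x + (n ∸ 1)) % n          ≡⟨ cong (_% n) (suc-+-pred (toℕ x)) ⟩
    (toℕ x + n) % n                    ≡⟨ toℕ-+n x ⟩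
    toℕ x                              ∎)
    where open ≡-Reasoning

  next-prev : ∀ x → next (prev x) ≡ x
  next-prev x = toℕ-injective (begin
    toℕ (next (prev x))                ≡⟨ toℕ-next (prev x) ⟩
    suc (toℕ (prev x)) % n             ≡⟨ cong (λ z → suc z % n) (toℕ-prev x) ⟩
    (1 + (toℕ x + (n ∸ 1)) % n) % n    ≡⟨ %-absorbʳ 1 (toℕ x + (n ∸ 1)) ⟩
    suc (toℕ x + (n ∸ 1)) % n          ≡⟨ cong (_% n) (suc-+-pred (toℕ x)) ⟩
    (toℕ x + n) % n                    ≡⟨ toℕ-+n x ⟩
    toℕ x                              ∎)
    where open ≡-Reasoning

  toℕ-iterate-next : ∀ (x : Fin n) i → toℕ (iterate next x i) ≡ (toℕ x + i) % n
  toℕ-iterate-next x zero = sym (trans (cong (_% n) (ℕP.+-identityʳ (toℕ x))) (m<n⇒m%n≡m (toℕ<n x)))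
  toℕ-iterate-next x (suc i) = begin
    toℕ (iterate next (next x) i)   ≡⟨ toℕ-iterate-next (next x) i ⟩
    (toℕ (next x) + i) % n          ≡⟨ cong (λ z → (z + i) % n) (toℕ-next x) ⟩
    (suc (toℕ x) % n + i) % n       ≡⟨ %-absorbˡ (suc (toℕ x)) i ⟩
    (suc (toℕ x) + i) % n           ≡⟨ cong (_% n) (ℕP.+-suc (toℕ x) i) ⟨
    (toℕ x + suc i) % n             ∎
    where open ≡-Reasoning

  -- a cycle of next of length d forces n to divide d
  next-aperiodic : Aperiodic next n
  next-aperiodic y d 0<d d<n eq = ℕP.<⇒≱ d<n (∣⇒≤ {{ℕ.>-nonZero 0<d}} (divides ((toℕ y + d) / n) d≡))
    where
    open ≡-Reasoning
    wraps : (toℕ y + d) % n ≡ toℕ y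
    wraps = trans (sym (toℕ-iterate-next y d)) (cong toℕ eq)
    d≡ : d ≡ ((toℕ y + d) / n) * n
    d≡ = ℕP.+-cancelˡ-≡ (toℕ y) d _ (begin
      toℕ y + d                                   ≡⟨ m≡m%n+[m/n]*n (toℕ y + d) n ⟩
      (toℕ y + d) % n + ((toℕ y + d) / n) * n     ≡⟨ cong (_+ ((toℕ y + d) / n) * n) wraps ⟩
      toℕ y + ((toℕ y + d) / n) * n               ∎)

  next-period : ∀ x → iterate next x n ≡ x
  next-period x = toℕ-injective (trans (toℕ-iterate-next x n) (toℕ-+n x))

  -- y is reached from x after (y - x) mod n steps
  next-reaches : ∀ x y → ∃[ i ] i < n × iterate next x i ≡ y
  next-reaches x y = i , m%n<n _ n , toℕ-injective (begin
    toℕ (iterate next x i)                ≡⟨ toℕ-iterate-next x i ⟩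
    (toℕ x + i) % n                       ≡⟨ %-absorbʳ (toℕ x) _ ⟩
    (toℕ x + (toℕ y + (n ∸ toℕ x))) % n   ≡⟨ cong (_% n) distance ⟩
    (toℕ y + n) % n                       ≡⟨ toℕ-+n y ⟩
    toℕ y                                 ∎)
    where
    open ≡-Reasoning
    i = (toℕ y + (n ∸ toℕ x)) % n
    distance : toℕ x + (toℕ y + (n ∸ toℕ x)) ≡ toℕ y + n
    distance = begin
      toℕ x + (toℕ y + (n ∸ toℕ x))   ≡⟨ ℕP.+-assoc (toℕ x) (toℕ y) _ ⟨
      (toℕ x + toℕ y) + (n ∸ toℕ x)   ≡⟨ cong (_+ (n ∸ toℕ x)) (ℕP.+-comm (toℕ x) (toℕ y)) ⟩
      (toℕ y + toℕ x) + (n ∸ toℕ x)   ≡⟨ ℕP.+-assoc (toℕ y) (toℕ x) _ ⟩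
      toℕ y + (toℕ x + (n ∸ toℕ x))   ≡⟨ cong (toℕ y +_) (ℕP.m+[n∸m]≡n (ℕP.<⇒≤ (toℕ<n x))) ⟩
      toℕ y + n                       ∎

  next-rotation : IsRotation n next prev
  next-rotation = record
    { left-inverse  = prev-next
    ; right-inverse = next-prev
    ; period        = next-period
    ; aperiodic     = next-aperiodic
    ; reaches       = next-reaches
    }

  module _ (n≥3 : 3 ≤ n) where

    next²≢id : ∀ x → next (next x) ≢ x
    next²≢id x = next-aperiodic x 2 (s≤s z≤n) n≥3

    next≢prev : ∀ x → next x ≢ prev x
    next≢prev x eq = next²≢id x (trans (cong next eq) (next-prev x))

first : List (ℕ × ℚ) → ℕ
first ((x , _) ∷ _) = x
first []            = 0

other : List (ℕ × ℚ) → ℕ → ℕ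
other ((x , _) ∷ (y , _) ∷ _) p = if does (x ℕ.≟ p) then y else x
other _                       p = 0

weightTo : List (ℕ × ℚ) → ℕ → ℚ
weightTo ((x , c) ∷ (y , d) ∷ _) q = if does (x ℕ.≟ q) then c else d
weightTo _                       q = 0ℚ

-- The controller state. ls is the identifier of the start vertex, p that of
-- the vertex just left (it fixes the direction of travel: continue to the
-- other neighbour).
--   outward ls i p P : i steps away from s in the first direction, having
--                      paid P so far;
--   sweep ls t p     : travelling in the second direction, turning before
--                      the vertex t (the turning point of the outward phase);
--   homeward ls p    : travelling back to s, stopping there.
data Phase : Set where
  start    : Phase
  outward  : (ls i p : ℕ) (P : ℚ) → Phase
  sweep    : (ls t p : ℕ) → Phase
  homeward : (ls p : ℕ) → Phase

homewardStep : (ls p : ℕ) → Observation → Move × Phase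
homewardStep ls p (ℓ , nb) =
  if does (ℓ ℕ.≟ ls) then (stop , homeward ls p) else (go (other nb p) , homeward ls ℓ)

-- on reaching the vertex before t the sweep turns round and acts as on the
-- way home, having come from t
sweepStep : (ls t p : ℕ) → Observation → Move × Phase
sweepStep ls t p (ℓ , nb) =
  if does (other nb p ℕ.≟ t)
  then homewardStep ls t (ℓ , nb)
  else (go (other nb p) , sweep ls t ℓ)

-- After k outward steps the searcher turns: it acts as a sweep that turns
-- before this very vertex, having come from the vertex ahead q. If q is s
-- and the edge to it is not heavier than the way back, it closes the cycle
-- instead.
outwardStep : (k ls i p : ℕ) (P : ℚ) → Observation → Move × Phase
outwardStep k ls i p P (ℓ , nb) =
  if does (i ℕ.≟ k)
  then (if does (q ℕ.≟ ls) ∧ does (weightTo nb q ℚP.≤? P)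
        then (go q , homeward ls ℓ)
        else sweepStep ls ℓ q (ℓ , nb))
  else (go q , outward ls (suc i) ℓ (P +ℚ weightTo nb q))
  where q = other nb p

-- The advice is the number k of outward steps; the first direction is
-- towards the neighbour of s listed first.
decide : ℕ → Phase → Observation → Move × Phase
decide k start (ℓ , nb)          = outwardStep k ℓ 0 (other nb (first nb)) 0ℚ (ℓ , nb)
decide k (outward ls i p P)      = outwardStep k ls i p P
decide k (sweep ls t p)          = sweepStep ls t p
decide k (homeward ls p)         = homewardStep ls p

phaseAfter : ℕ → List Observation → Phase
phaseAfter k []      = start
phaseAfter k (o ∷ h) = proj₂ (decide k (phaseAfter k h) o)

-- little-endian binary reading of the advice
decode : List Bool → ℕ
decode []       = 0
decode (b ∷ bs) = (if b then 1 else 0) + 2 * decode bs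

explorer : Algorithm
explorer adv []      = stop
explorer adv (o ∷ h) = proj₁ (decide (decode adv) (phaseAfter (decode adv) h) o)

+-cancelˡ-≤ : ∀ a {b c} → a +ℚ b ≤ℚ a +ℚ c → b ≤ℚ c
+-cancelˡ-≤ a a+b≤a+c = ℚP.≮⇒≥ λ c<b → ℚP.<-irrefl refl (ℚP.≤-<-trans a+b≤a+c (ℚP.+-mono-≤-< (ℚP.≤-refl {a}) c<b))

·-zeroʳ : ∀ m → m · 0ℚ ≡ 0ℚ
·-zeroʳ zero    = refl
·-zeroʳ (suc m) = trans (ℚP.+-identityˡ _) (·-zeroʳ m)

·-monoˡ-≤ : ∀ {m m′} q → m ≤ m′ → 0ℚ ≤ℚ q → m · q ≤ℚ m′ · q
·-monoˡ-≤ {zero}  {zero}   q _         _   = ℚP.≤-refl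
·-monoˡ-≤ {zero}  {suc m′} q _         q≥0 = ℚP.+-mono-≤ q≥0 (·-monoˡ-≤ {zero} {m′} q z≤n q≥0)
·-monoˡ-≤ {suc m} {suc m′} q (s≤s m≤m′) q≥0 = ℚP.+-monoʳ-≤ q (·-monoˡ-≤ q m≤m′ q≥0)

·-monoʳ-≤ : ∀ m {a b} → a ≤ℚ b → m · a ≤ℚ m · b
·-monoʳ-≤ zero    a≤b = ℚP.≤-refl
·-monoʳ-≤ (suc m) a≤b = ℚP.+-mono-≤ a≤b (·-monoʳ-≤ m a≤b)

module WeightedLists {n : ℕ} (w : Fin n → ℚ) (w≥0 : ∀ x → 0ℚ ≤ℚ w x) where

  sumW : List (Fin n) → ℚ
  sumW []       = 0ℚ
  sumW (x ∷ xs) = w x +ℚ sumW xs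

  sumW-nonneg : ∀ xs → 0ℚ ≤ℚ sumW xs
  sumW-nonneg []       = ℚP.≤-refl
  sumW-nonneg (x ∷ xs) = ℚP.+-mono-≤ (w≥0 x) (sumW-nonneg xs)

  sumW-++ : ∀ xs ys → sumW (xs ++ ys) ≡ sumW xs +ℚ sumW ys
  sumW-++ []       ys = sym (ℚP.+-identityˡ (sumW ys))
  sumW-++ (x ∷ xs) ys = trans (cong (w x +ℚ_) (sumW-++ xs ys)) (sym (ℚP.+-assoc (w x) (sumW xs) (sumW ys)))

  sumW-middle : ∀ xs x ys → sumW (xs ++ x ∷ ys) ≡ w x +ℚ sumW (xs ++ ys)
  sumW-middle []       x ys = refl
  sumW-middle (y ∷ xs) x ys = trans (cong (w y +ℚ_) (sumW-middle xs x ys)) (x∙yz≈y∙xz (w y) (w x) _)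

  count : Fin n → List (Fin n) → ℕ
  count x []       = 0
  count x (y ∷ ys) with x FinP.≟ y
  ... | yes _ = suc (count x ys)
  ... | no  _ = count x ys

  without : Fin n → List (Fin n) → List (Fin n)
  without x = filter (λ y → ¬? (x FinP.≟ y))

  sumW-split : ∀ x ys → sumW ys ≡ count x ys · w x +ℚ sumW (without x ys)
  sumW-split x []       = sym (ℚP.+-identityˡ 0ℚ)
  sumW-split x (y ∷ ys) with x FinP.≟ y
  ... | yes refl = trans (cong (w x +ℚ_) (sumW-split x ys))
                         (sym (ℚP.+-assoc (w x) (count x ys · w x) _))
  ... | no  _    = trans (cong (w y +ℚ_) (sumW-split x ys))
                         (x∙yz≈y∙xz (w y) (count x ys · w x) _)

  count-≢ : ∀ {x y} ys → x ≢ y → count x (y ∷ ys) ≡ count x ys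
  count-≢ {x} {y} ys x≢y with x FinP.≟ y
  ... | yes x≡y = ⊥-elim (x≢y x≡y)
  ... | no  _   = refl

  count-without : ∀ x y ys → y ≢ x → count y (without x ys) ≡ count y ys
  count-without x y []       y≢x = refl
  count-without x y (z ∷ zs) y≢x with x FinP.≟ z
  ... | yes refl = trans (count-without x y zs y≢x) (sym (count-≢ zs y≢x))
  ... | no  _ with y FinP.≟ z
  ...   | yes _ = cong suc (count-without x y zs y≢x)
  ...   | no  _ = count-without x y zs y≢x

  count-++ : ∀ x xs ys → count x (xs ++ ys) ≡ count x xs + count x ys
  count-++ x []       ys = refl
  count-++ x (y ∷ xs) ys with x FinP.≟ y
  ... | yes _ = cong suc (count-++ x xs ys)
  ... | no  _ = count-++ x xs ys

  ∈⇒count : ∀ {x ys} → x ∈ ys → 1 ≤ count x ys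
  ∈⇒count {x} {y ∷ ys} x∈ with x FinP.≟ y
  ∈⇒count {x} {y ∷ ys} x∈         | yes _ = s≤s z≤n
  ∈⇒count {x} {y ∷ ys} (here x≡y) | no x≢y = ⊥-elim (x≢y x≡y)
  ∈⇒count {x} {y ∷ ys} (there x∈) | no _   = ∈⇒count x∈

  count-∉ : ∀ {x ys} → All (x ≢_) ys → count x ys ≡ 0
  count-∉ {x} {[]}     []           = refl
  count-∉ {x} {y ∷ ys} (x≢y ∷ x∉) with x FinP.≟ y
  ... | yes x≡y = ⊥-elim (x≢y x≡y)
  ... | no  _   = count-∉ x∉

  count-unique : ∀ {x ys} → Unique ys → x ∈ ys → count x ys ≡ 1
  count-unique {x} {y ∷ ys} (y∉ ∷ u) x∈ with x FinP.≟ y | x∈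
  ... | yes refl | _         = cong suc (count-∉ y∉)
  ... | no x≢y   | here x≡y  = ⊥-elim (x≢y x≡y)
  ... | no _     | there x∈′ = count-unique u x∈′

  sum-bound : ∀ m U ys → Unique U → (∀ x → x ∈ U → m ≤ count x ys) → m · sumW U ≤ℚ sumW ys
  sum-bound m [] ys _ _ = subst (_≤ℚ sumW ys) (sym (·-zeroʳ m)) (sumW-nonneg ys)
  sum-bound m (x ∷ U) ys (x∉U ∷ u) often = begin
    m · (w x +ℚ sumW U)                                  ≡⟨ ·-distrib-+ (w x) (sumW U) m ⟩
    m · w x +ℚ m · sumW U                                ≤⟨ ℚP.+-mono-≤ (·-monoˡ-≤ (w x) (often x (here refl)) (w≥0 x)) rest ⟩
    count x ys · w x +ℚ sumW (without x ys)              ≡⟨ sumW-split x ys ⟨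
    sumW ys                                              ∎
    where
    open ℚP.≤-Reasoning
    rest : m · sumW U ≤ℚ sumW (without x ys)
    rest = sum-bound m U (without x ys) u λ y y∈U →
      subst (m ≤_) (sym (count-without x y ys (λ y≡x → All.lookup x∉U y∈U (sym y≡x))))
            (often y (there y∈U))

  total : ℚ
  total = sumW (allFin n)

  pathWeight : Fin n → ℚ
  pathWeight x = sumW (without x (allFin n))

  total-split : ∀ x → total ≡ w x +ℚ pathWeight x
  total-split x = begin
    total                                            ≡⟨ sumW-split x (allFin n) ⟩
    count x (allFin n) · w x +ℚ pathWeight x         ≡⟨ cong (λ c → c · w x +ℚ pathWeight x) once ⟩
    (w x +ℚ 0ℚ) +ℚ pathWeight x                      ≡⟨ cong (_+ℚ pathWeight x) (ℚP.+-identityʳ (w x)) ⟩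
    w x +ℚ pathWeight x                              ∎
    where
    open ≡-Reasoning
    once : count x (allFin n) ≡ 1
    once = count-unique (Uniqueₚ.allFin⁺ n) (∈-allFin x)

  unique-bound : ∀ {U} → Unique U → sumW U ≤ℚ total
  unique-bound {U} u = subst (_≤ℚ total) (ℚP.+-identityʳ (sumW U))
    (sum-bound 1 U (allFin n) u (λ x _ → ∈⇒count (∈-allFin x)))

  avoid-bound : ∀ xs x ys → Unique (xs ++ x ∷ ys) → sumW (xs ++ ys) ≤ℚ pathWeight x
  avoid-bound xs x ys u = +-cancelˡ-≤ (w x) (begin
    w x +ℚ sumW (xs ++ ys)  ≡⟨ sumW-middle xs x ys ⟨
    sumW (xs ++ x ∷ ys)     ≤⟨ unique-bound u ⟩
    total                   ≡⟨ total-split x ⟩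
    w x +ℚ pathWeight x     ∎)
    where open ℚP.≤-Reasoning

  pathWeight-antitone : ∀ x y → w y ≤ℚ w x → pathWeight x ≤ℚ pathWeight y
  pathWeight-antitone x y wy≤wx = +-cancelˡ-≤ (w x) (begin
    w x +ℚ pathWeight x   ≡⟨ total-split x ⟨
    total                 ≡⟨ total-split y ⟩
    w y +ℚ pathWeight y   ≤⟨ ℚP.+-monoˡ-≤ (pathWeight y) wy≤wx ⟩
    w x +ℚ pathWeight y   ∎)
    where open ℚP.≤-Reasoning

weight-nonneg : ∀ {n} .{{_ : NonZero n}} (G : CycleGraph n) x → 0ℚ ≤ℚ weight G x
weight-nonneg G x = ℚP.<⇒≤ (ℚP.positive⁻¹ _ {{weight-pos G x}})

module WalkEdges {n : ℕ} .{{_ : NonZero n}} where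
  open CycleArithmetic

  -- the edge crossed by the step x → y, named as in CycleGraph: edge i
  -- joins i and next i
  Ed : Fin n → Fin n → Fin n
  Ed x y with y FinP.≟ next x
  ... | yes _ = x
  ... | no  _ = y

  Es : List (Fin n) → List (Fin n)
  Es []          = []
  Es (x ∷ [])    = []
  Es (x ∷ y ∷ r) = Ed x y ∷ Es (y ∷ r)

  Es-cons : ∀ x {y} W → head W ≡ just y → Es (x ∷ W) ≡ Ed x y ∷ Es W
  Es-cons x (y ∷ W) refl = refl

  Es-trace : ∀ d x m {W} → head W ≡ just (iterate d x m) →
             Es (trace d x m ++ W) ≡ applyUpTo (λ j → Ed (iterate d x j) (d (iterate d x j))) m ++ Es W
  Es-trace d x zero    hd = refl
  Es-trace d x (suc m) {W} hd =
    trans (Es-cons x (trace d (d x) m ++ W) (head-trace d (d x) m hd))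
          (cong (Ed x (d x) ∷_) (Es-trace d (d x) m hd))

  module _ (n≥3 : 3 ≤ n) where

    Ed-next : ∀ x → Ed x (next x) ≡ x
    Ed-next x with next x FinP.≟ next x
    ... | yes _   = refl
    ... | no  x≢x = ⊥-elim (x≢x refl)

    Ed-from-next : ∀ y → Ed (next y) y ≡ y
    Ed-from-next y with y FinP.≟ next (next y)
    ... | yes eq = ⊥-elim (next²≢id n≥3 y (sym eq))
    ... | no  _  = refl

    Ed-sym : ∀ {x y} → Adj x y → Ed x y ≡ Ed y x
    Ed-sym {x} (inj₁ refl) = trans (Ed-next x) (sym (Ed-from-next x))
    Ed-sym {_} {y} (inj₂ refl) = trans (Ed-from-next y) (sym (Ed-next y))

    module _ (G : CycleGraph n) where
      open WeightedLists (weight G) (weight-nonneg G)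

      stepCost-next : ∀ x → stepCost G x (next x) ≡ weight G x
      stepCost-next x with next x FinP.≟ next x
      ... | yes _   = refl
      ... | no  x≢x = ⊥-elim (x≢x refl)

      stepCost-from-next : ∀ y → stepCost G (next y) y ≡ weight G y
      stepCost-from-next y with y FinP.≟ next (next y)
      ... | yes eq = ⊥-elim (next²≢id n≥3 y (sym eq))
      ... | no  _ with next y FinP.≟ next y
      ...   | yes _   = refl
      ...   | no  y≢y = ⊥-elim (y≢y refl)

      stepCost-Ed : ∀ {x y} → Adj x y → stepCost G x y ≡ weight G (Ed x y)
      stepCost-Ed {x}     (inj₁ refl) = trans (stepCost-next x) (cong (weight G) (sym (Ed-next x)))
      stepCost-Ed {_} {y} (inj₂ refl) = trans (stepCost-from-next y) (cong (weight G) (sym (Ed-from-next y)))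

      walkCost-Es : ∀ W → AdjChain W → walkCost G W ≡ sumW (Es W)
      walkCost-Es []          _         = refl
      walkCost-Es (x ∷ [])    _         = refl
      walkCost-Es (x ∷ y ∷ W) (xy , ch) = cong₂ _+ℚ_ (stepCost-Ed xy) (walkCost-Es (y ∷ W) ch)

-- The searcher's first direction is towards the neighbour of s with the
-- smaller identifier. An orientation packages that direction (fwd, with
-- inverse bwd) together with everything the analysis needs to know about
-- how observations look when travelling along it.

module Observations {n : ℕ} .{{_ : NonZero n}} (n≥3 : 3 ≤ n) (G : CycleGraph n) where
  open CycleArithmetic
  open WalkEdges

  lp ln : Fin n → ℕ
  lp v = label G (prev v)
  ln v = label G (next v)

  lp≢ln : ∀ v → lp v ≢ ln v
  lp≢ln v eq = next≢prev n≥3 v (sym (label-inj G eq))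

  other-after-prev : ∀ v → other (sortedNbrs G v) (lp v) ≡ ln v
  other-after-prev v with lp v ℕP.≤? ln v
  ... | yes _ rewrite dec-true (lp v ℕ.≟ lp v) refl = refl
  ... | no  _ rewrite dec-false (ln v ℕ.≟ lp v) (λ eq → lp≢ln v (sym eq)) = refl

  other-after-next : ∀ v → other (sortedNbrs G v) (ln v) ≡ lp v
  other-after-next v with lp v ℕP.≤? ln v
  ... | yes _ rewrite dec-false (lp v ℕ.≟ ln v) (lp≢ln v) = refl
  ... | no  _ rewrite dec-true (ln v ℕ.≟ ln v) refl = refl

  weightTo-next : ∀ v → weightTo (sortedNbrs G v) (ln v) ≡ weight G v
  weightTo-next v with lp v ℕP.≤? ln v
  ... | yes _ rewrite dec-false (lp v ℕ.≟ ln v) (lp≢ln v) = refl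
  ... | no  _ rewrite dec-true (ln v ℕ.≟ ln v) refl = refl

  weightTo-prev : ∀ v → weightTo (sortedNbrs G v) (lp v) ≡ weight G (prev v)
  weightTo-prev v with lp v ℕP.≤? ln v
  ... | yes _ rewrite dec-true (lp v ℕ.≟ lp v) refl = refl
  ... | no  _ rewrite dec-false (ln v ℕ.≟ lp v) (λ eq → lp≢ln v (sym eq)) = refl

  moveTo-next : ∀ v → moveTo G v (ln v) ≡ just (next v)
  moveTo-next v with ln v ℕ.≟ ln v
  ... | yes _   = refl
  ... | no  x≢x = ⊥-elim (x≢x refl)

  moveTo-prev : ∀ v → moveTo G v (lp v) ≡ just (prev v)
  moveTo-prev v with lp v ℕ.≟ ln v
  ... | yes eq = ⊥-elim (lp≢ln v eq)
  ... | no  _ with lp v ℕ.≟ lp v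
  ...   | yes _   = refl
  ...   | no  x≢x = ⊥-elim (x≢x refl)

  first-prev : ∀ v → lp v ≤ ln v → first (sortedNbrs G v) ≡ lp v
  first-prev v lp≤ln with lp v ℕP.≤? ln v
  ... | yes _    = refl
  ... | no  lp≰ln = ⊥-elim (lp≰ln lp≤ln)

  first-next : ∀ v → ¬ lp v ≤ ln v → first (sortedNbrs G v) ≡ ln v
  first-next v lp≰ln with lp v ℕP.≤? ln v
  ... | yes lp≤ln = ⊥-elim (lp≰ln lp≤ln)
  ... | no  _     = refl

  moveTo-adjacent : ∀ {v} x {w} → moveTo G v x ≡ just w → Adj v w
  moveTo-adjacent {v} x eq with x ℕ.≟ label G (next v)
  moveTo-adjacent {v} x refl | yes _ = inj₁ refl
  ... | no _ with x ℕ.≟ label G (prev v)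
  moveTo-adjacent {v} x refl | no _ | yes _ = inj₂ (sym (next-prev v))
  moveTo-adjacent {v} x ()   | no _ | no _

  record Orientation (s : Fin n) : Set where
    field
      fwd bwd fwdEdge    : Fin n → Fin n
      rotation           : IsRotation n fwd bwd
      Ed-fwd             : ∀ v → Ed v (fwd v) ≡ fwdEdge v
      fwdEdge-injective  : ∀ {x y} → fwdEdge x ≡ fwdEdge y → x ≡ y
      fwdEdge-surjective : ∀ x → ∃[ y ] fwdEdge y ≡ x
      move-fwd           : ∀ v → moveTo G v (label G (fwd v)) ≡ just (fwd v)
      move-bwd           : ∀ v → moveTo G v (label G (bwd v)) ≡ just (bwd v)
      other-after-bwd    : ∀ v → other (sortedNbrs G v) (label G (bwd v)) ≡ label G (fwd v)
      other-after-fwd    : ∀ v → other (sortedNbrs G v) (label G (fwd v)) ≡ label G (bwd v)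
      weightTo-fwd       : ∀ v → weightTo (sortedNbrs G v) (label G (fwd v)) ≡ weight G (fwdEdge v)
      first-at-s         : first (sortedNbrs G s) ≡ label G (fwd s)

    open IsRotation rotation public

    Ed-bwd : ∀ v → Ed v (bwd v) ≡ fwdEdge (bwd v)
    Ed-bwd v = begin
      Ed v (bwd v)             ≡⟨ Ed-sym n≥3 (moveTo-adjacent (label G (bwd v)) (move-bwd v)) ⟩
      Ed (bwd v) v             ≡⟨ cong (Ed (bwd v)) (right-inverse v) ⟨
      Ed (bwd v) (fwd (bwd v)) ≡⟨ Ed-fwd (bwd v) ⟩
      fwdEdge (bwd v)          ∎
      where open ≡-Reasoning

  orientation : ∀ s → Orientation s
  orientation s with lp s ℕP.≤? ln s
  ... | yes lp≤ln = record
    { fwd = prev ; bwd = next ; fwdEdge = prev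
    ; rotation           = reverse next-rotation
    ; Ed-fwd             = Ed-prev
    ; fwdEdge-injective  = λ {x} {y} eq → trans (sym (next-prev x)) (trans (cong next eq) (next-prev y))
    ; fwdEdge-surjective = λ x → next x , prev-next x
    ; move-fwd = moveTo-prev ; move-bwd = moveTo-next
    ; other-after-bwd = other-after-next ; other-after-fwd = other-after-prev
    ; weightTo-fwd = weightTo-prev
    ; first-at-s = first-prev s lp≤ln
    }
    where
    Ed-prev : ∀ v → Ed v (prev v) ≡ prev v
    Ed-prev v with prev v FinP.≟ next v
    ... | yes eq = ⊥-elim (next≢prev n≥3 v (sym eq))
    ... | no  _  = refl
  ... | no lp≰ln = record
    { fwd = next ; bwd = prev ; fwdEdge = λ x → x
    ; rotation           = next-rotation
    ; Ed-fwd             = Ed-next n≥3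
    ; fwdEdge-injective  = λ eq → eq
    ; fwdEdge-surjective = λ x → x , refl
    ; move-fwd = moveTo-next ; move-bwd = moveTo-prev
    ; other-after-bwd = other-after-prev ; other-after-fwd = other-after-next
    ; weightTo-fwd = weightTo-next
    ; first-at-s = first-next s lp≰ln
    }

module Runs {n : ℕ} .{{_ : NonZero n}} (n≥3 : 3 ≤ n) (G : CycleGraph n) (k : ℕ) where
  open Observations n≥3 G using (moveTo-adjacent)

  -- Follows σ W: with advice k, the controller started in phase σ at the
  -- first vertex of W walks exactly along W and stops at its last vertex.
  data Follows : Phase → List (Fin n) → Set where
    stops : ∀ {σ v} → proj₁ (decide k σ (observe G v)) ≡ stop → Follows σ (v ∷ [])
    moves : ∀ {σ σ′ v w ws} → decide k σ (observe G v) ≡ (go (label G w) , σ′) →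
            moveTo G v (label G w) ≡ just w → Follows σ′ (w ∷ ws) → Follows σ (v ∷ w ∷ ws)

  moves-to : ∀ {σ σ′ v w W} → decide k σ (observe G v) ≡ (go (label G w) , σ′) →
             moveTo G v (label G w) ≡ just w → Follows σ′ W → head W ≡ just w → Follows σ (v ∷ W)
  moves-to {W = w ∷ _} d m f refl = moves d m f

  retarget : ∀ {σ σ′ v W} → head W ≡ just v →
             decide k σ (observe G v) ≡ decide k σ′ (observe G v) → Follows σ′ W → Follows σ W
  retarget {W = v ∷ _} refl same (stops st)    = stops (trans (cong proj₁ same) st)
  retarget {W = v ∷ _} refl same (moves d m f) = moves (trans same d) m f

  follows-adjacent : ∀ {σ W} → Follows σ W → AdjChain W
  follows-adjacent (stops _)     = tt
  follows-adjacent (moves {w = w} _ m f) = moveTo-adjacent (label G w) m , follows-adjacent f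

  follows-trace : ∀ (d : Fin n → Fin n) → (∀ v → moveTo G v (label G (d v)) ≡ just (d v)) →
    ∀ (σ : ℕ → Phase) x m {W} →
    (∀ j → j < m → decide k (σ j) (observe G (iterate d x j)) ≡ (go (label G (d (iterate d x j))) , σ (suc j))) →
    Follows (σ m) W → head W ≡ just (iterate d x m) → Follows (σ 0) (trace d x m ++ W)
  follows-trace d move σ x zero    step f hd = f
  follows-trace d move σ x (suc m) step f hd =
    moves-to (step 0 (s≤s z≤n)) (move x)
      (follows-trace d move (σ ∘ suc) (d x) m (λ j j<m → step (suc j) (s≤s j<m)) f hd)
      (head-trace d (d x) m hd)

  run-follows : ∀ adv → decode adv ≡ k → ∀ {σ} v ws h fuel → Follows σ (v ∷ ws) →
                phaseAfter k h ≡ σ → length ws ≤ fuel → runFrom G explorer adv fuel v h ≡ just (v ∷ ws)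
  run-follows adv dk v [] h fuel (stops st) ph _ with explorer adv (observe G v ∷ h) | stopped
    where
    stopped : explorer adv (observe G v ∷ h) ≡ stop
    stopped rewrite dk | ph = st
  ... | .stop | refl = refl
  run-follows adv dk v (w ∷ ws) h (suc fuel) (moves {σ′ = σ′} d m f) ph (s≤s len)
    with explorer adv (observe G v ∷ h) | moved
    where
    moved : explorer adv (observe G v ∷ h) ≡ go (label G w)
    moved rewrite dk | ph | d = refl
  ... | .(go (label G w)) | refl with moveTo G v (label G w) | m
  ...   | .(just w) | refl = cong (Maybe.map (v ∷_)) (run-follows adv dk w ws (observe G v ∷ h) fuel f ph′ len)
    where
    ph′ : phaseAfter k (observe G v ∷ h) ≡ σ′
    ph′ rewrite ph | d = refl

  run-performs : ∀ adv → decode adv ≡ k → ∀ {s W} → Follows start W → head W ≡ just s →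
                 run G explorer adv (length W) s ≡ just W
  run-performs adv dk {W = v ∷ ws} f refl = run-follows adv dk v ws [] (length (v ∷ ws)) f refl (ℕP.n≤1+n _)

-- Lower bound: every exploration costs at least the total weight, or twice
-- the weight of the path left after deleting some edge e.
--
-- If an exploration misses the edge e, then for every other edge f the cut
-- {e , f} separates the cycle into two arcs; the walk goes from s to the far
-- arc and back, crossing the cut on each way, necessarily through f.

module LowerBound {n : ℕ} .{{_ : NonZero n}} (n≥3 : 3 ≤ n) (G : CycleGraph n) where
  open CycleArithmetic
  open WalkEdges
  open WeightedLists (weight G) (weight-nonneg G)
  open DecMembership (FinP._≟_ {n}) using (_∈?_)

  Es-split : ∀ xs v ys → Es (xs ++ v ∷ ys) ≡ Es (xs ++ v ∷ []) ++ Es (v ∷ ys)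
  Es-split []            v ys = refl
  Es-split (x ∷ [])      v ys = refl
  Es-split (x ∷ x′ ∷ xs) v ys = cong (Ed x x′ ∷_) (Es-split (x′ ∷ xs) v ys)

  AdjChain-split : ∀ xs v ys → AdjChain (xs ++ v ∷ ys) → AdjChain (xs ++ v ∷ []) × AdjChain (v ∷ ys)
  AdjChain-split []            v ys ch       = tt , ch
  AdjChain-split (x ∷ [])      v ys (a , ch) = (a , tt) , ch
  AdjChain-split (x ∷ x′ ∷ xs) v ys (a , ch) =
    let (chP , chQ) = AdjChain-split (x′ ∷ xs) v ys ch in (a , chP) , chQ

  head-split : ∀ xs (v : Fin n) ys → head (xs ++ v ∷ []) ≡ head (xs ++ v ∷ ys)
  head-split []      v ys = refl
  head-split (x ∷ _) v ys = refl

  CrossedTwice : Fin n → Fin n → List (Fin n) → Set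
  CrossedTwice e f W =
    ∃[ P ] ∃[ Q ] (Es W ≡ Es P ++ Es Q) × ((e ∈ Es P) ⊎ (f ∈ Es P)) × ((e ∈ Es Q) ⊎ (f ∈ Es Q))

  -- the vertices of the arc (lo , hi], with lo < hi
  module Arc (lo hi : Fin n) (lo<hi : toℕ lo < toℕ hi) where

    inside : Fin n → Bool
    inside v = does (toℕ lo ℕ.<? toℕ v) ∧ does (toℕ v ℕP.≤? toℕ hi)

    lo-outside : inside lo ≡ false
    lo-outside rewrite dec-false (toℕ lo ℕ.<? toℕ lo) (ℕP.<-irrefl refl) = refl

    hi-inside : inside hi ≡ true
    hi-inside rewrite dec-true (toℕ lo ℕ.<? toℕ hi) lo<hi | dec-true (toℕ hi ℕP.≤? toℕ hi) ℕP.≤-refl = refl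

    inside-next : ∀ x → x ≢ lo → x ≢ hi → inside x ≡ inside (next x)
    inside-next x x≢lo x≢hi with ℕP.m≤n⇒m<n∨m≡n (toℕ<n x)
    ... | inj₁ 1+x<n = cong₂ _∧_
      (does-⇔ (mk⇔ after-lo⇒ after-lo⇐) (toℕ lo ℕ.<? toℕ x) (toℕ lo ℕ.<? toℕ (next x)))
      (does-⇔ (mk⇔ upto-hi⇒ upto-hi⇐) (toℕ x ℕP.≤? toℕ hi) (toℕ (next x) ℕP.≤? toℕ hi))
      where
      next≡ : toℕ (next x) ≡ suc (toℕ x)
      next≡ = trans (toℕ-next x) (m<n⇒m%n≡m 1+x<n)
      after-lo⇒ : toℕ lo < toℕ x → toℕ lo < toℕ (next x)
      after-lo⇒ lo<x rewrite next≡ = ℕP.m<n⇒m<1+n lo<x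
      after-lo⇐ : toℕ lo < toℕ (next x) → toℕ lo < toℕ x
      after-lo⇐ lo<x′ rewrite next≡ = ℕP.≤∧≢⇒< (ℕP.≤-pred lo<x′) (λ eq → x≢lo (toℕ-injective (sym eq)))
      upto-hi⇒ : toℕ x ≤ toℕ hi → toℕ (next x) ≤ toℕ hi
      upto-hi⇒ x≤hi rewrite next≡ = ℕP.≤∧≢⇒< x≤hi (λ eq → x≢hi (toℕ-injective eq))
      upto-hi⇐ : toℕ (next x) ≤ toℕ hi → toℕ x ≤ toℕ hi
      upto-hi⇐ x′≤hi rewrite next≡ = ℕP.<⇒≤ x′≤hi
    ... | inj₂ 1+x≡n = begin
      inside x                                      ≡⟨ cong (does (toℕ lo ℕ.<? toℕ x) ∧_) (dec-false (toℕ x ℕP.≤? toℕ hi) x≰hi) ⟩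
      does (toℕ lo ℕ.<? toℕ x) ∧ false              ≡⟨ Data.Bool.Properties.∧-zeroʳ _ ⟩
      false                                         ≡⟨ cong (_∧ does (toℕ (next x) ℕP.≤? toℕ hi)) (dec-false (toℕ lo ℕ.<? toℕ (next x)) lo≮x′) ⟨
      inside (next x)                               ∎
      where
      open ≡-Reasoning
      -- x is the last vertex, beyond hi; next x is the first, not after lo
      x≰hi : ¬ toℕ x ≤ toℕ hi
      x≰hi x≤hi = x≢hi (toℕ-injective (ℕP.≤-antisym x≤hi (ℕP.≤-pred (subst (toℕ hi <_) (sym 1+x≡n) (toℕ<n hi)))))
      lo≮x′ : ¬ toℕ lo < toℕ (next x)
      lo≮x′ lo<x′ with subst (toℕ lo <_) (trans (toℕ-next x) (trans (cong (_% n) 1+x≡n) (n%n≡0 n))) lo<x′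
      ... | ()

    endpoint : ∀ x → (x ≢ lo → x ≢ hi → ⊥) → (x ≡ lo) ⊎ (x ≡ hi)
    endpoint x neither with x FinP.≟ lo | x FinP.≟ hi
    ... | yes x≡lo | _        = inj₁ x≡lo
    ... | no  _    | yes x≡hi = inj₂ x≡hi
    ... | no x≢lo  | no x≢hi  = ⊥-elim (neither x≢lo x≢hi)

    crossing-step : ∀ {x y} → Adj x y → inside x ≢ inside y → (Ed x y ≡ lo) ⊎ (Ed x y ≡ hi)
    crossing-step {x} (inj₁ refl) differ rewrite Ed-next n≥3 x =
      endpoint x (λ x≢lo x≢hi → differ (inside-next x x≢lo x≢hi))
    crossing-step {_} {y} (inj₂ refl) differ rewrite Ed-from-next n≥3 y =
      endpoint y (λ y≢lo y≢hi → differ (sym (inside-next y y≢lo y≢hi)))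

    crossing-walk′ : ∀ x W {b} → AdjChain (x ∷ W) → last (x ∷ W) ≡ just b →
                     inside x ≢ inside b → (lo ∈ Es (x ∷ W)) ⊎ (hi ∈ Es (x ∷ W))
    crossing-walk′ x []      _         refl differ = ⊥-elim (differ refl)
    crossing-walk′ x (y ∷ W) (xy , ch) l    differ with Data.Bool._≟_ (inside x) (inside y)
    ... | no changes = Data.Sum.map (here ∘ sym) (here ∘ sym) (crossing-step xy changes)
    ... | yes same   = Data.Sum.map there there (crossing-walk′ y W ch l (λ eq → differ (trans same eq)))

    crossing-walk : ∀ W {a b} → AdjChain W → head W ≡ just a → last W ≡ just b →
                    inside a ≢ inside b → (lo ∈ Es W) ⊎ (hi ∈ Es W)
    crossing-walk (x ∷ W) ch refl = crossing-walk′ x W ch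

    -- a closed walk from s through lo and hi crosses the cut before and after
    -- visiting the side opposite to s
    halves : ∀ {s W} → head W ≡ just s → last W ≡ just s → AdjChain W → lo ∈ W → hi ∈ W →
             CrossedTwice lo hi W
    halves {s} {W} hd ls ch lo∈W hi∈W with opposite (inside s) refl
      where
      opposite : ∀ b → inside s ≡ b → ∃[ v ] v ∈ W × (inside s ≢ inside v)
      opposite true  eq = lo , lo∈W , λ eq′ → Data.Bool.Properties.not-¬ refl (trans (sym eq) (trans eq′ lo-outside))
      opposite false eq = hi , hi∈W , λ eq′ → Data.Bool.Properties.not-¬ refl (trans (sym eq) (trans eq′ hi-inside))
    ... | v , v∈W , differ with ∈-∃++ v∈W
    ... | xs , ys , refl =
      let (chP , chQ) = AdjChain-split xs v ys ch in
      xs ++ v ∷ [] , v ∷ ys , Es-split xs v ys ,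
      crossing-walk (xs ++ v ∷ []) chP (trans (head-split xs v ys) hd) (last-++ xs v []) differ ,
      crossing-walk (v ∷ ys) chQ refl (trans (sym (last-++ xs v ys)) ls) (differ ∘ sym)

  crossedTwice-sym : ∀ {e f W} → CrossedTwice e f W → CrossedTwice f e W
  crossedTwice-sym (P , Q , split , cP , cQ) = P , Q , split , Data.Sum.swap cP , Data.Sum.swap cQ

  crossedTwice-count : ∀ {e f W} → CrossedTwice e f W → e ∉ Es W → 2 ≤ count f (Es W)
  crossedTwice-count {e} {f} {W} (P , Q , split , cP , cQ) e∉ =
    subst (2 ≤_) (sym (trans (cong (count f) split) (count-++ f (Es P) (Es Q))))
          (ℕP.+-mono-≤ (∈⇒count (through-f ∈-++⁺ˡ cP)) (∈⇒count (through-f (∈-++⁺ʳ (Es P)) cQ)))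
    where
    through-f : ∀ {E} → (∀ {x} → x ∈ E → x ∈ Es P ++ Es Q) → (e ∈ E) ⊎ (f ∈ E) → f ∈ E
    through-f into (inj₁ e∈) = ⊥-elim (e∉ (subst (e ∈_) (sym split) (into e∈)))
    through-f into (inj₂ f∈) = f∈

  crosses-twice : ∀ {s W} → IsExploration s W → ∀ e f → f ≢ e → e ∉ Es W → 2 ≤ count f (Es W)
  crosses-twice (hd , ls , ch , visits) e f f≢e e∉ with ℕP.<-cmp (toℕ e) (toℕ f)
  ... | tri< e<f _ _ = crossedTwice-count (Arc.halves e f e<f hd ls ch (visits e) (visits f)) e∉
  ... | tri≈ _ e≡f _ = ⊥-elim (f≢e (toℕ-injective (sym e≡f)))
  ... | tri> _ _ f<e = crossedTwice-count (crossedTwice-sym (Arc.halves f e f<e hd ls ch (visits f) (visits e))) e∉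

  exploration-cost : ∀ {s W} → IsExploration s W →
                     (total ≤ℚ walkCost G W) ⊎ (∃[ e ] 2 · pathWeight e ≤ℚ walkCost G W)
  exploration-cost {s} {W} ex@(_ , _ , ch , _) rewrite walkCost-Es n≥3 G W ch
    with FinP.all? (λ e → e ∈? Es W)
  ... | yes every = inj₁ (subst (_≤ℚ sumW (Es W)) (ℚP.+-identityʳ total)
                       (sum-bound 1 (allFin n) (Es W) (Uniqueₚ.allFin⁺ n) (λ x _ → ∈⇒count (every x))))
  ... | no ¬every = let (e , e∉) = FinP.¬∀⟶∃¬ n _ (λ e → e ∈? Es W) ¬every in
    inj₂ (e , sum-bound 2 (without e (allFin n)) (Es W) (Uniqueₚ.filter⁺ (λ y → ¬? (e FinP.≟ y)) (Uniqueₚ.allFin⁺ n))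
                λ f f∈ → crosses-twice ex e f (λ f≡e → proj₂ (∈-filter⁻ (λ y → ¬? (e FinP.≟ y)) {xs = allFin n} f∈) (sym f≡e)) e∉)

-- The walk performed with advice k, on a cycle with n = k + 1 + m vertices
--
-- Positions are counted from s in the first direction: u j is the vertex j
-- steps ahead and e j the edge from u j to u (j + 1). The searcher walks to
-- u k; there it either closes the cycle through e k (possible only if
-- m = 0, and chosen when e k is at most as heavy as the way back), or it
-- sweeps back through s around the cycle up to u (k + 1) and returns home.
-- Either way every edge but e k is crossed at most twice.

module Execution {n : ℕ} .{{_ : NonZero n}} (n≥3 : 3 ≤ n) (G : CycleGraph n) (s : Fin n)
                 (k m : ℕ) (n≡ : n ≡ suc (k + m)) where
  open WalkEdges
  open WeightedLists (weight G) (weight-nonneg G)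
  open Observations n≥3 G using (Orientation; orientation)
  open Orientation (orientation s)
  open Runs n≥3 G k

  ls : ℕ
  ls = label G s

  u : ℕ → Fin n
  u = iterate fwd s

  e : ℕ → Fin n
  e j = fwdEdge (u j)

  prefix : ℕ → ℚ
  prefix zero    = 0ℚ
  prefix (suc j) = prefix j +ℚ weight G (e j)

  v : ℕ → Fin n
  v = iterate bwd (u k)

  y : ℕ → Fin n
  y = iterate fwd (fwd (u k))

  outwardPhase : ℕ → Phase
  outwardPhase j = outward ls j (label G (bwd (u j))) (prefix j)

  sweepPhase : ℕ → Phase
  sweepPhase j = sweep ls (label G (u k)) (label G (fwd (v j)))

  homewardPhase : ℕ → Phase
  homewardPhase j = homeward ls (label G (bwd (y j)))

  closes : Bool
  closes = does (label G (fwd (u k)) ℕ.≟ ls) ∧ does (weight G (e k) ℚP.≤? prefix k)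

  u-distinct : ∀ {i j} → i < j → j < n → u i ≢ u j
  u-distinct = iterate-distinct aperiodic s

  fwd-u : ∀ j → fwd (u j) ≡ u (suc j)
  fwd-u j = sym (iterate-suc fwd s j)

  bwd-u : ∀ j → bwd (u (suc j)) ≡ u j
  bwd-u j = trans (cong bwd (sym (fwd-u j))) (left-inverse (u j))

  y≡u : ∀ j → y j ≡ u (k + suc j)
  y≡u j = sym (iterate-+ fwd s k (suc j))

  bwd-y : ∀ j → bwd (y (suc j)) ≡ y j
  bwd-y j = trans (cong bwd (iterate-suc fwd (fwd (u k)) j)) (left-inverse (y j))

  v-suc : ∀ j → v (suc j) ≡ bwd (v j)
  v-suc j = iterate-suc bwd (u k) j

  fwd-v : ∀ j → fwd (v (suc j)) ≡ v j
  fwd-v j = trans (cong fwd (v-suc j)) (right-inverse (v j))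

  home-reached : y m ≡ s
  home-reached = trans (y≡u m) (trans (cong u (trans (ℕP.+-suc k m) (sym n≡))) (period s))

  sweep-end : v (k + m) ≡ fwd (u k)
  sweep-end = begin
    v (k + m)                 ≡⟨ right-inverse (v (k + m)) ⟨
    fwd (bwd (v (k + m)))     ≡⟨ cong fwd (v-suc (k + m)) ⟨
    fwd (v (suc (k + m)))     ≡⟨ cong (fwd ∘ v) n≡ ⟨
    fwd (v n)                 ≡⟨ cong fwd (IsRotation.period (reverse rotation) (u k)) ⟩
    fwd (u k)                 ∎
    where open ≡-Reasoning

  sweep-avoids-uk : ∀ j → j < k + m → label G (bwd (v j)) ≢ label G (u k)
  sweep-avoids-uk j j<k+m eq = iterate-distinct (IsRotation.aperiodic (reverse rotation)) (u k) (s≤s z≤n)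
    (subst (suc j <_) (sym n≡) (s≤s j<k+m)) (sym (trans (v-suc j) (label-inj G eq)))

  home-avoids-s : ∀ j → j < m → label G (y j) ≢ ls
  home-avoids-s j j<m eq = u-distinct (ℕP.<-≤-trans (s≤s z≤n) (ℕP.m≤n+m (suc j) k)) (subst (k + suc j <_) (trans (ℕP.+-suc k m) (sym n≡)) (ℕP.+-monoʳ-< k (s≤s j<m)))
    (sym (trans (sym (y≡u j)) (label-inj G eq)))

  start-as-outward : decide k start (observe G s) ≡ decide k (outwardPhase 0) (observe G s)
  start-as-outward = cong (λ p → outwardStep k ls 0 p 0ℚ (observe G s))
                          (trans (cong (other (sortedNbrs G s)) first-at-s) (other-after-fwd s))

  outward-step : ∀ j → j < k →
    decide k (outwardPhase j) (observe G (u j)) ≡ (go (label G (fwd (u j))) , outwardPhase (suc j))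
  outward-step j j<k rewrite dec-false (j ℕ.≟ k) (ℕP.<⇒≢ j<k) | other-after-bwd (u j) | weightTo-fwd (u j)
                           | bwd-u j = refl

  closing-move : Move × Phase
  closing-move = go (label G (fwd (u k))) , homeward ls (label G (u k))

  turn : decide k (outwardPhase k) (observe G (u k)) ≡
         (if closes then closing-move else decide k (sweepPhase 0) (observe G (u k)))
  turn rewrite dec-true (k ℕ.≟ k) refl | other-after-bwd (u k) | weightTo-fwd (u k) = refl

  sweep-step : ∀ j → j < k + m →
    decide k (sweepPhase j) (observe G (v j)) ≡ (go (label G (bwd (v j))) , sweepPhase (suc j))
  sweep-step j j<k+m rewrite other-after-fwd (v j)
                           | dec-false (label G (bwd (v j)) ℕ.≟ label G (u k)) (sweep-avoids-uk j j<k+m)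
    = cong (λ x → go (label G (bwd (v j))) , sweep ls (label G (u k)) (label G x)) (sym (fwd-v j))

  sweep-turn : decide k (sweepPhase (k + m)) (observe G (fwd (u k))) ≡
               decide k (homewardPhase 0) (observe G (fwd (u k)))
  sweep-turn rewrite sweep-end | other-after-fwd (fwd (u k)) | left-inverse (u k)
                   | dec-true (label G (u k) ℕ.≟ label G (u k)) refl = refl

  homeward-step : ∀ j → j < m →
    decide k (homewardPhase j) (observe G (y j)) ≡ (go (label G (fwd (y j))) , homewardPhase (suc j))
  homeward-step j j<m rewrite dec-false (label G (y j) ℕ.≟ ls) (home-avoids-s j j<m) | other-after-bwd (y j)
                            | bwd-y j = refl

  stops-at-s : ∀ p → proj₁ (decide k (homeward ls p) (observe G s)) ≡ stop
  stops-at-s p rewrite dec-true (ls ℕ.≟ ls) refl = refl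

  homeLeg : List (Fin n)
  homeLeg = trace fwd (fwd (u k)) m ++ s ∷ []

  sweepLeg : List (Fin n)
  sweepLeg = trace bwd (u k) (k + m) ++ homeLeg

  skipWalk : List (Fin n)
  skipWalk = trace fwd s k ++ sweepLeg

  tourWalk : List (Fin n)
  tourWalk = trace fwd s k ++ u k ∷ fwd (u k) ∷ []

  head-homeLeg : head homeLeg ≡ just (fwd (u k))
  head-homeLeg = head-trace fwd (fwd (u k)) m (cong just (sym home-reached))

  head-sweepLeg : head sweepLeg ≡ just (u k)
  head-sweepLeg = head-trace bwd (u k) (k + m) (trans head-homeLeg (cong just (sym sweep-end)))

  homeLeg-follows : Follows (homewardPhase 0) homeLeg
  homeLeg-follows = follows-trace fwd move-fwd homewardPhase (fwd (u k)) m homeward-step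
    (stops (stops-at-s _)) (cong just (sym home-reached))

  sweepLeg-follows : Follows (sweepPhase 0) sweepLeg
  sweepLeg-follows = follows-trace bwd move-bwd sweepPhase (u k) (k + m) sweep-step
    (retarget head-homeLeg sweep-turn homeLeg-follows) (trans head-homeLeg (cong just (sym sweep-end)))

  outward-follows : ∀ {W} → head W ≡ just (u k) → Follows (outwardPhase k) W → Follows start (trace fwd s k ++ W)
  outward-follows hd f = retarget (head-trace fwd s k hd) start-as-outward
                                  (follows-trace fwd move-fwd outwardPhase s k outward-step f hd)

  skipWalk-follows : closes ≡ false → Follows start skipWalk
  skipWalk-follows open′ = outward-follows head-sweepLeg (retarget head-sweepLeg sweeps sweepLeg-follows)
    where
    sweeps : decide k (outwardPhase k) (observe G (u k)) ≡ decide k (sweepPhase 0) (observe G (u k))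
    sweeps = trans turn (cong (λ b → if b then closing-move else decide k (sweepPhase 0) (observe G (u k))) open′)

  closes⇒returns : closes ≡ true → fwd (u k) ≡ s
  closes⇒returns c = label-inj G {fwd (u k)} {s} (does-true (label G (fwd (u k)) ℕ.≟ ls)
    (Data.Bool.Properties.∧-conicalˡ _ (does (weight G (e k) ℚP.≤? prefix k)) c))

  returns⇒m≡0 : fwd (u k) ≡ s → m ≡ 0
  returns⇒m≡0 eq with m ℕ.≟ 0
  ... | yes m≡0 = m≡0
  ... | no  m≢0 = ⊥-elim (u-distinct (s≤s z≤n) 1+k<n (sym (trans (sym (fwd-u k)) eq)))
    where
    1+k<n : suc k < n
    1+k<n = subst (suc k <_) (sym n≡) (s≤s (ℕP.m<m+n k (ℕP.n≢0⇒n>0 m≢0)))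

  tourWalk-follows : closes ≡ true → Follows start tourWalk
  tourWalk-follows c = outward-follows refl (moves closing (move-fwd (u k)) (stops at-home))
    where
    closing : decide k (outwardPhase k) (observe G (u k)) ≡ closing-move
    closing = trans turn (cong (λ b → if b then closing-move else decide k (sweepPhase 0) (observe G (u k))) c)
    at-home : proj₁ (decide k (homeward ls (label G (u k))) (observe G (fwd (u k)))) ≡ stop
    at-home = subst (λ x → proj₁ (decide k (homeward ls (label G (u k))) (observe G x)) ≡ stop)
                    (sym (closes⇒returns c)) (stops-at-s _)

  -- the edges crossed: e 0 … e (k - 1) outward, every edge but e k during
  -- the sweep, and e (k + 1) … e (n - 1) on the way home

  outwardEdges sweepEdges homeEdges : List (Fin n)
  outwardEdges = applyUpTo e k
  sweepEdges   = applyUpTo (λ j → fwdEdge (v (suc j))) (k + m)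
  homeEdges    = applyUpTo (λ j → e (k + suc j)) m

  Es-outward : ∀ {W} → head W ≡ just (u k) → Es (trace fwd s k ++ W) ≡ outwardEdges ++ Es W
  Es-outward {W} hd = trans (Es-trace fwd s k hd) (cong (_++ Es W) (applyUpTo-cong (Ed-fwd ∘ u) k))

  Es-skipWalk : Es skipWalk ≡ outwardEdges ++ sweepEdges ++ homeEdges ++ []
  Es-skipWalk = begin
    Es skipWalk                                     ≡⟨ Es-outward head-sweepLeg ⟩
    outwardEdges ++ Es sweepLeg                     ≡⟨ cong (outwardEdges ++_) Es-sweepLeg ⟩
    outwardEdges ++ sweepEdges ++ Es homeLeg        ≡⟨ cong (λ E → outwardEdges ++ sweepEdges ++ E) Es-homeLeg ⟩
    outwardEdges ++ sweepEdges ++ homeEdges ++ []   ∎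
    where
    open ≡-Reasoning
    Es-sweepLeg : Es sweepLeg ≡ sweepEdges ++ Es homeLeg
    Es-sweepLeg = trans (Es-trace bwd (u k) (k + m) (trans head-homeLeg (cong just (sym sweep-end))))
      (cong (_++ Es homeLeg) (applyUpTo-cong (λ j → trans (Ed-bwd (v j)) (cong fwdEdge (sym (v-suc j)))) (k + m)))
    Es-homeLeg : Es homeLeg ≡ homeEdges ++ []
    Es-homeLeg = trans (Es-trace fwd (fwd (u k)) m (cong just (sym home-reached)))
      (cong (_++ []) (applyUpTo-cong (λ j → trans (Ed-fwd (y j)) (cong fwdEdge (y≡u j))) m))

  Es-tourWalk : Es tourWalk ≡ outwardEdges ++ e k ∷ []
  Es-tourWalk = trans (Es-outward refl) (cong (λ x → outwardEdges ++ x ∷ []) (Ed-fwd (u k)))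

  edges-unique : ∀ {d} → Aperiodic d n → ∀ x → Unique (applyUpTo (λ j → fwdEdge (iterate d x j)) n)
  edges-unique ap x = Uniqueₚ.applyUpTo⁺₁ _ n λ i<j j<n eq → iterate-distinct ap x i<j j<n (fwdEdge-injective eq)

  outward-home-unique : Unique (outwardEdges ++ e k ∷ homeEdges)
  outward-home-unique = subst Unique all-edges (edges-unique aperiodic s)
    where
    open ≡-Reasoning
    all-edges : applyUpTo e n ≡ outwardEdges ++ e k ∷ homeEdges
    all-edges = begin
      applyUpTo e n                                                ≡⟨ cong (applyUpTo e) (trans n≡ (sym (ℕP.+-suc k m))) ⟩
      applyUpTo e (k + suc m)                                      ≡⟨ applyUpTo-++ e k (suc m) ⟩
      outwardEdges ++ e (k + 0) ∷ homeEdges                        ≡⟨ cong (λ i → outwardEdges ++ e i ∷ homeEdges) (ℕP.+-identityʳ k) ⟩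
      outwardEdges ++ e k ∷ homeEdges                              ∎

  sweep-unique : Unique (e k ∷ sweepEdges)
  sweep-unique = subst (λ N → Unique (applyUpTo (λ j → fwdEdge (v j)) N)) n≡
                       (edges-unique (IsRotation.aperiodic (reverse rotation)) (u k))

  outward-home-bound : sumW (outwardEdges ++ homeEdges) ≤ℚ pathWeight (e k)
  outward-home-bound = avoid-bound outwardEdges (e k) homeEdges outward-home-unique

  sweep-bound : sumW sweepEdges ≤ℚ pathWeight (e k)
  sweep-bound = avoid-bound [] (e k) sweepEdges sweep-unique

  outward-bound : sumW outwardEdges ≤ℚ pathWeight (e k)
  outward-bound = begin
    sumW outwardEdges                      ≡⟨ ℚP.+-identityʳ _ ⟨
    sumW outwardEdges +ℚ 0ℚ                ≤⟨ ℚP.+-monoʳ-≤ (sumW outwardEdges) (sumW-nonneg homeEdges) ⟩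
    sumW outwardEdges +ℚ sumW homeEdges    ≡⟨ sumW-++ outwardEdges homeEdges ⟨
    sumW (outwardEdges ++ homeEdges)       ≤⟨ outward-home-bound ⟩
    pathWeight (e k)                       ∎
    where open ℚP.≤-Reasoning

  prefix-sum : ∀ j → prefix j ≡ sumW (applyUpTo e j)
  prefix-sum zero    = refl
  prefix-sum (suc j) = begin
    prefix j +ℚ weight G (e j)                      ≡⟨ cong (_+ℚ weight G (e j)) (prefix-sum j) ⟩
    sumW (applyUpTo e j) +ℚ weight G (e j)          ≡⟨ cong (sumW (applyUpTo e j) +ℚ_) (ℚP.+-identityʳ _) ⟨
    sumW (applyUpTo e j) +ℚ sumW (e j ∷ [])         ≡⟨ sumW-++ (applyUpTo e j) (e j ∷ []) ⟨
    sumW (applyUpTo e j ∷ʳ e j)                     ≡⟨ cong sumW (applyUpTo-∷ʳ e j) ⟩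
    sumW (applyUpTo e (suc j))                      ∎
    where open ≡-Reasoning

  outwardCost sweepCost homeCost : ℚ
  outwardCost = sumW outwardEdges
  sweepCost   = sumW sweepEdges
  homeCost    = sumW homeEdges

  skipWalk-cost : AdjChain skipWalk → walkCost G skipWalk ≡ outwardCost +ℚ (sweepCost +ℚ (homeCost +ℚ 0ℚ))
  skipWalk-cost ch = begin
    walkCost G skipWalk                                           ≡⟨ walkCost-Es n≥3 G skipWalk ch ⟩
    sumW (Es skipWalk)                                            ≡⟨ cong sumW Es-skipWalk ⟩
    sumW (outwardEdges ++ sweepEdges ++ homeEdges ++ [])          ≡⟨ sumW-++ outwardEdges _ ⟩
    outwardCost +ℚ sumW (sweepEdges ++ homeEdges ++ [])           ≡⟨ cong (outwardCost +ℚ_) (sumW-++ sweepEdges _) ⟩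
    outwardCost +ℚ (sweepCost +ℚ sumW (homeEdges ++ []))          ≡⟨ cong (λ c → outwardCost +ℚ (sweepCost +ℚ c)) (sumW-++ homeEdges []) ⟩
    outwardCost +ℚ (sweepCost +ℚ (homeCost +ℚ 0ℚ))                ∎
    where open ≡-Reasoning

  tourWalk-cost : AdjChain tourWalk → walkCost G tourWalk ≡ outwardCost +ℚ (weight G (e k) +ℚ 0ℚ)
  tourWalk-cost ch = begin
    walkCost G tourWalk                        ≡⟨ walkCost-Es n≥3 G tourWalk ch ⟩
    sumW (Es tourWalk)                         ≡⟨ cong sumW Es-tourWalk ⟩
    sumW (outwardEdges ++ e k ∷ [])            ≡⟨ sumW-++ outwardEdges (e k ∷ []) ⟩
    outwardCost +ℚ (weight G (e k) +ℚ 0ℚ)      ∎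
    where open ≡-Reasoning

  record Outcome : Set where
    field
      walk       : List (Fin n)
      follows    : Follows start walk
      explores   : IsExploration s walk
      path-bound : walkCost G walk ≤ℚ 2 · pathWeight (e k)
      tour-bound : m ≡ 0 → walkCost G walk ≤ℚ total

  skipWalk-visits : ∀ x → x ∈ skipWalk
  skipWalk-visits x with IsRotation.reaches (reverse rotation) (u k) x
  ... | j , j<n , refl with ℕP.m≤n⇒m<n∨m≡n (ℕP.≤-pred (subst (j <_) n≡ j<n))
  ...   | inj₁ j<k+m = ∈-++⁺ʳ (trace fwd s k) (∈-++⁺ˡ (∈-applyUpTo⁺ (iterate bwd (u k)) j<k+m))
  ...   | inj₂ refl  = ∈-++⁺ʳ (trace fwd s k) (∈-++⁺ʳ (trace bwd (u k) (k + m))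
                         (subst (_∈ homeLeg) (sym sweep-end) (head-∈ head-homeLeg)))

  skip-outcome : closes ≡ false → Outcome
  skip-outcome open′ = record
    { walk       = skipWalk
    ; follows    = performed
    ; explores   = head-trace fwd s k head-sweepLeg , ends-home , adjacent , skipWalk-visits
    ; path-bound = path-bound
    ; tour-bound = tour-bound
    }
    where
    open ℚP.≤-Reasoning
    performed = skipWalk-follows open′
    adjacent  = follows-adjacent performed
    ends-home : last skipWalk ≡ just s
    ends-home = last-++-just (trace fwd s k) (last-++-just (trace bwd (u k) (k + m)) (last-++ (trace fwd (fwd (u k)) m) s []))

    path-bound : walkCost G skipWalk ≤ℚ 2 · pathWeight (e k)
    path-bound = begin
      walkCost G skipWalk                                   ≡⟨ skipWalk-cost adjacent ⟩
      outwardCost +ℚ (sweepCost +ℚ (homeCost +ℚ 0ℚ))        ≡⟨ x∙yz≈y∙xz outwardCost sweepCost _ ⟩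
      sweepCost +ℚ (outwardCost +ℚ (homeCost +ℚ 0ℚ))        ≡⟨ cong (sweepCost +ℚ_) (ℚP.+-assoc outwardCost homeCost 0ℚ) ⟨
      sweepCost +ℚ ((outwardCost +ℚ homeCost) +ℚ 0ℚ)        ≡⟨ cong (λ c → sweepCost +ℚ (c +ℚ 0ℚ)) (sumW-++ outwardEdges homeEdges) ⟨
      sweepCost +ℚ (sumW (outwardEdges ++ homeEdges) +ℚ 0ℚ) ≤⟨ ℚP.+-mono-≤ sweep-bound (ℚP.+-monoˡ-≤ 0ℚ outward-home-bound) ⟩
      2 · pathWeight (e k)                                  ∎

    -- with m = 0 the searcher turned because e k was heavier than the way back
    tour-bound : m ≡ 0 → walkCost G skipWalk ≤ℚ total
    tour-bound m≡0 = begin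
      walkCost G skipWalk                              ≡⟨ skipWalk-cost adjacent ⟩
      outwardCost +ℚ (sweepCost +ℚ (homeCost +ℚ 0ℚ))   ≡⟨ cong (λ c → outwardCost +ℚ (sweepCost +ℚ (c +ℚ 0ℚ))) no-home ⟩
      outwardCost +ℚ (sweepCost +ℚ 0ℚ)                 ≡⟨ cong (outwardCost +ℚ_) (ℚP.+-identityʳ sweepCost) ⟩
      outwardCost +ℚ sweepCost                         ≤⟨ ℚP.+-mono-≤ (ℚP.<⇒≤ lighter) sweep-bound ⟩
      weight G (e k) +ℚ pathWeight (e k)               ≡⟨ total-split (e k) ⟨
      total                                            ∎
      where
      no-home : homeCost ≡ 0ℚ
      no-home = cong (λ i → sumW (applyUpTo (λ j → e (k + suc j)) i)) m≡0
      returns : label G (fwd (u k)) ≡ ls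
      returns = cong (label G) (subst (λ i → y i ≡ s) m≡0 home-reached)
      heavier : ¬ weight G (e k) ≤ℚ prefix k
      heavier = does-false (weight G (e k) ℚP.≤? prefix k)
        (subst (λ b → b ∧ does (weight G (e k) ℚP.≤? prefix k) ≡ false)
               (dec-true (label G (fwd (u k)) ℕ.≟ ls) returns) open′)
      lighter : outwardCost <ℚ weight G (e k)
      lighter = subst (_<ℚ weight G (e k)) (prefix-sum k) (ℚP.≰⇒> heavier)

  tour-outcome : closes ≡ true → Outcome
  tour-outcome c = record
    { walk       = tourWalk
    ; follows    = performed
    ; explores   = head-trace fwd s k refl , ends-home , adjacent , visits
    ; path-bound = path-bound
    ; tour-bound = λ _ → tour-bound
    }
    where
    open ℚP.≤-Reasoning
    performed = tourWalk-follows c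
    adjacent  = follows-adjacent performed
    ends-home : last tourWalk ≡ just s
    ends-home = trans (last-++ (trace fwd s k) (u k) (fwd (u k) ∷ [])) (cong just (closes⇒returns c))

    visits : ∀ x → x ∈ tourWalk
    visits x with reaches s x
    ... | j , j<n , refl with ℕP.m≤n⇒m<n∨m≡n (ℕP.≤-pred (subst (j <_) (trans n≡ (cong (λ i → suc (k + i)) (returns⇒m≡0 (closes⇒returns c)))) j<n))
    ...   | inj₁ j<k+0 = ∈-++⁺ˡ (∈-applyUpTo⁺ u (subst (j <_) (ℕP.+-identityʳ k) j<k+0))
    ...   | inj₂ j≡k+0 = ∈-++⁺ʳ (trace fwd s k) (here (cong u (trans j≡k+0 (ℕP.+-identityʳ k))))

    lighter : weight G (e k) ≤ℚ outwardCost
    lighter = subst (weight G (e k) ≤ℚ_) (prefix-sum k)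
      (does-true (weight G (e k) ℚP.≤? prefix k) (Data.Bool.Properties.∧-conicalʳ (does (label G (fwd (u k)) ℕ.≟ ls)) _ c))

    path-bound : walkCost G tourWalk ≤ℚ 2 · pathWeight (e k)
    path-bound = begin
      walkCost G tourWalk                          ≡⟨ tourWalk-cost adjacent ⟩
      outwardCost +ℚ (weight G (e k) +ℚ 0ℚ)        ≤⟨ ℚP.+-mono-≤ outward-bound (ℚP.+-monoˡ-≤ 0ℚ (ℚP.≤-trans lighter outward-bound)) ⟩
      2 · pathWeight (e k)                         ∎

    tour-bound : walkCost G tourWalk ≤ℚ total
    tour-bound = begin
      walkCost G tourWalk                          ≡⟨ tourWalk-cost adjacent ⟩
      outwardCost +ℚ (weight G (e k) +ℚ 0ℚ)        ≡⟨ cong (outwardCost +ℚ_) (ℚP.+-identityʳ _) ⟩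
      outwardCost +ℚ weight G (e k)                ≡⟨ ℚP.+-comm outwardCost _ ⟩
      weight G (e k) +ℚ outwardCost                ≤⟨ ℚP.+-monoʳ-≤ (weight G (e k)) outward-bound ⟩
      weight G (e k) +ℚ pathWeight (e k)           ≡⟨ total-split (e k) ⟨
      total                                        ∎

  outcome : Outcome
  outcome with closes in c
  ... | false = skip-outcome c
  ... | true  = tour-outcome c

-- The advice: k < n written with ⌈log₂ n⌉ bits, least significant first

lowBit : ℕ → Bool
lowBit zero          = false
lowBit (suc zero)    = true
lowBit (suc (suc k)) = lowBit k

bitValue : Bool → ℕ
bitValue b = if b then 1 else 0

lowBit-⌊/2⌋ : ∀ k → bitValue (lowBit k) + 2 * ⌊ k /2⌋ ≡ k
lowBit-⌊/2⌋ zero          = refl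
lowBit-⌊/2⌋ (suc zero)    = refl
lowBit-⌊/2⌋ (suc (suc k)) = begin
  bitValue (lowBit k) + 2 * suc ⌊ k /2⌋       ≡⟨ cong (bitValue (lowBit k) +_) (ℕP.*-suc 2 ⌊ k /2⌋) ⟩
  bitValue (lowBit k) + (2 + 2 * ⌊ k /2⌋)     ≡⟨ ℕP.+-suc (bitValue (lowBit k)) _ ⟩
  suc (bitValue (lowBit k) + suc (2 * ⌊ k /2⌋)) ≡⟨ cong suc (ℕP.+-suc (bitValue (lowBit k)) _) ⟩
  suc (suc (bitValue (lowBit k) + 2 * ⌊ k /2⌋)) ≡⟨ cong (suc ∘ suc) (lowBit-⌊/2⌋ k) ⟩
  suc (suc k)                                  ∎
  where open ≡-Reasoning

encode : ℕ → ℕ → List Bool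
encode zero    k = []
encode (suc L) k = lowBit k ∷ encode L ⌊ k /2⌋

encode-length : ∀ L k → length (encode L k) ≡ L
encode-length zero    k = refl
encode-length (suc L) k = cong suc (encode-length L ⌊ k /2⌋)

decode-encode : ∀ L k → k < 2 ^ L → decode (encode L k) ≡ k
decode-encode zero    zero    _           = refl
decode-encode zero    (suc k) (s≤s ())
decode-encode (suc L) k k<2^L+1 = trans (cong (λ d → bitValue (lowBit k) + 2 * d) (decode-encode L ⌊ k /2⌋ half<))
                                        (lowBit-⌊/2⌋ k)
  where
  half< : ⌊ k /2⌋ < 2 ^ L
  half< = ℕP.*-cancelˡ-< 2 ⌊ k /2⌋ (2 ^ L)
            (ℕP.≤-<-trans (ℕP.m+n≤o⇒n≤o (bitValue (lowBit k)) (ℕP.≤-reflexive (lowBit-⌊/2⌋ k))) k<2^L+1)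

≤-2^⌈log₂⌉ : ∀ n → n ≤ 2 ^ ⌈log₂ n ⌉
≤-2^⌈log₂⌉ n = bound n (Data.Nat.Induction.<-wellFounded n)
  where
  bound : ∀ n (acc-n : Acc _<_ n) → n ≤ 2 ^ ⌈log2⌉ n acc-n
  bound zero                _          = z≤n
  bound (suc zero)          _          = s≤s z≤n
  bound (suc (suc n)) (acc rs) = ℕP.≤-trans twice-half (ℕP.*-monoʳ-≤ 2 (bound (suc ⌈ n /2⌉) _))
    where
    c = ⌈ n /2⌉
    n≤c+c : n ≤ c + c
    n≤c+c = subst (_≤ c + c) (ℕP.⌊n/2⌋+⌈n/2⌉≡n n) (ℕP.+-monoˡ-≤ c (ℕP.⌊n/2⌋≤⌈n/2⌉ n))
    twice-half : suc (suc n) ≤ 2 * suc c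
    twice-half = subst (suc (suc n) ≤_) (sym (trans (cong (suc c +_) (ℕP.+-identityʳ (suc c))) (cong suc (ℕP.+-suc c c))))
                       (s≤s (s≤s n≤c+c))

-- Choosing the advice
--
-- Let e* be a heaviest edge. If going round the cycle is at most twice as
-- heavy as the path avoiding e*, the advice is the last position n - 1;
-- otherwise it is the position of e*. In both cases the walk performed
-- beats both lower bounds.

module Optimality {n : ℕ} .{{_ : NonZero n}} (n≥3 : 3 ≤ n) (G : CycleGraph n) (s : Fin n) where
  open WeightedLists (weight G) (weight-nonneg G)
  open Observations n≥3 G using (orientation; module Orientation)
  open Orientation (orientation s) using (fwdEdge-surjective; reaches)
  open LowerBound n≥3 G using (exploration-cost)
  open Execution n≥3 G s using (module Outcome; outcome)
  module Max = Data.List.Extrema (DecTotalOrder.totalOrder ℚP.≤-decTotalOrder)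

  heaviest : Fin n
  heaviest = Max.argmax (weight G) s (allFin n)

  lightest-path : ∀ x → 2 · pathWeight heaviest ≤ℚ 2 · pathWeight x
  lightest-path x = ·-monoʳ-≤ 2 (pathWeight-antitone heaviest x
                      (All.lookup (Max.f[xs]≤f[argmax] s (allFin n)) (∈-allFin x)))

  Optimal : List (Fin n) → Set
  Optimal W = ∀ W′ → IsExploration s W′ → walkCost G W ≤ℚ walkCost G W′

  optimal : ∀ W → walkCost G W ≤ℚ total → (∀ x → walkCost G W ≤ℚ 2 · pathWeight x) → Optimal W
  optimal W ≤total ≤paths W′ ex with exploration-cost ex
  ... | inj₁ total≤          = ℚP.≤-trans ≤total total≤
  ... | inj₂ (x , 2·path≤)   = ℚP.≤-trans (≤paths x) 2·path≤

  best-advice : ∃[ k ] ∃[ m ] Σ (n ≡ suc (k + m)) λ n≡ → Optimal (Outcome.walk (outcome k m n≡))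
  best-advice with total ℚP.≤? 2 · pathWeight heaviest
  ... | yes tour-lighter = n ∸ 1 , 0 , n≡ ,
          optimal (Outcome.walk result) tour (λ x → ℚP.≤-trans tour (ℚP.≤-trans tour-lighter (lightest-path x)))
    where
    n≡ : n ≡ suc (n ∸ 1 + 0)
    n≡ = trans (sym (ℕP.suc-pred n)) (cong suc (sym (ℕP.+-identityʳ (n ∸ 1))))
    result = outcome (n ∸ 1) 0 n≡
    tour : walkCost G (Outcome.walk result) ≤ℚ total
    tour = Outcome.tour-bound result refl
  ... | no tour-heavier = k , n ∸ suc k , n≡ ,
          optimal (Outcome.walk result) (ℚP.<⇒≤ (ℚP.≤-<-trans path (ℚP.≰⇒> tour-heavier)))
                  (λ x → ℚP.≤-trans path (lightest-path x))
    where
    position = reaches s (proj₁ (fwdEdge-surjective heaviest))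
    k = proj₁ position
    n≡ : n ≡ suc (k + (n ∸ suc k))
    n≡ = sym (ℕP.m+[n∸m]≡n (proj₁ (proj₂ position)))
    at-heaviest : Execution.e n≥3 G s k (n ∸ suc k) n≡ k ≡ heaviest
    at-heaviest = trans (cong (Orientation.fwdEdge (orientation s)) (proj₂ (proj₂ position)))
                        (proj₂ (fwdEdge-surjective heaviest))
    result = outcome k (n ∸ suc k) n≡
    path : walkCost G (Outcome.walk result) ≤ℚ 2 · pathWeight heaviest
    path = subst (λ x → walkCost G (Outcome.walk result) ≤ℚ 2 · pathWeight x) at-heaviest (Outcome.path-bound result)

theorem4 : Σ Algorithm λ A →
    ∀ (n : ℕ) .{{_ : NonZero n}} → 3 ≤ n → (G : CycleGraph n) → (s : Fin n) →
    Σ (List Bool) λ adv → (length adv ≡ ⌈log₂ n ⌉) ×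
      Σ ℕ λ fuel → Σ (List (Fin n)) λ W →
        (run G A adv fuel s ≡ just W) × IsExploration s W ×
        (∀ W' → IsExploration s W' → walkCost G W ℚ.≤ walkCost G W')
theorem4 = explorer , λ n n≥3 G s →
  let (k , m , n≡ , optimal) = Optimality.best-advice n≥3 G s
      open Execution.Outcome (Execution.outcome n≥3 G s k m n≡)
      k<2^L = ℕP.<-≤-trans (subst (k <_) (sym n≡) (s≤s (ℕP.m≤m+n k m))) (≤-2^⌈log₂⌉ n)
      adv   = encode ⌈log₂ n ⌉ k
  in adv , encode-length ⌈log₂ n ⌉ k , length walk , walk ,
     Runs.run-performs n≥3 G k adv (decode-encode ⌈log₂ n ⌉ k k<2^L) follows (proj₁ explores) ,
     explores , optimal
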